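{- $\mathrm{K4}=\bigcap_{n\ge0}\mathrm{K4}\mathbb{C}_n$.
   Context: Modal formulas are built from variables by $\top,\neg,\wedge,\Box$, with $\Diamond=\neg\Box\neg$, $\Box^*\varphi=\varphi\wedge\Box\varphi$. A normal logic is a set of formulas containing all tautologies and all instances of $\Box(\varphi\to\psi)\to(\Box\varphi\to\Box\psi)$, closed under modus ponens, $\Box$-generalisation and uniform substitution. $\mathrm{K4}$ is the smallest normal logic containing all instances of $\Box\varphi\to\Box\Box\varphi$. Define $\mathbb{P}_0(\varphi_0)=\Diamond\varphi_0$, $\mathbb{P}_n(\varphi_0,\dots,\varphi_n)=\Diamond(\varphi_1\wedge\mathbb{P}_{n-1}(\varphi_0,\varphi_2,\dots,\varphi_n))$ for $n>0$; $\mathbb{D}_n=\bigwedge_{i<j\le n}\neg(\varphi_i\wedge\varphi_j)$ ($=\top$ if $n=0$); $\mathbb{C}_n$ is the scheme $\Box^*\mathbb{D}_n\to(\Diamond\varphi_0\to\Diamond(\varphi_0\wedge\neg\mathbb{P}_n))$. $\mathrm{K4}\mathbb{C}_n$ is the smallest normal logic containing $\mathrm{K4}$ and all instances of $\mathbb{C}_n$. -}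

module Defs where

open import Data.Nat using (ℕ; zero; suc)
open import Data.Bool using (Bool; true; false; not; _∧_)
open import Data.Fin using (Fin; zero; suc; inject₁; fromℕ)
open import Data.List using (List; []; _∷_; foldr; map)
open import Data.Fin.Base using ()
open import Data.Product using (Σ; ∃; _,_)
open import Relation.Binary.PropositionalEquality using (_≡_)

data Fm : Set where
  var : ℕ → Fm
  ⊤ₘ  : Fm
  ¬ₘ_ : Fm → Fm
  _∧ₘ_ : Fm → Fm → Fm
  □_  : Fm → Fm

infixr 30 ¬ₘ_ □_ ◇_
infixr 25 _∧ₘ_
infixr 20 _⇒_

_⇒_ : Fm → Fm → Fm
φ ⇒ ψ = ¬ₘ (φ ∧ₘ ¬ₘ ψ)

◇_ : Fm → Fm
◇ φ = ¬ₘ □ ¬ₘ φ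

□* : Fm → Fm
□* φ = φ ∧ₘ □ φ

-- Propositional tautologies of the modal language: true under every
-- Boolean valuation of variables and of boxed subformulas (treated as atoms).
eval : (ℕ → Bool) → (Fm → Bool) → Fm → Bool
eval v w (var p)  = v p
eval v w ⊤ₘ       = true
eval v w (¬ₘ φ)   = not (eval v w φ)
eval v w (φ ∧ₘ ψ) = eval v w φ ∧ eval v w ψ
eval v w (□ φ)    = w φ

Tautology : Fm → Set
Tautology φ = ∀ (v : ℕ → Bool) (w : Fm → Bool) → eval v w φ ≡ true

sub : (ℕ → Fm) → Fm → Fm
sub σ (var p)  = σ p
sub σ ⊤ₘ       = ⊤ₘ
sub σ (¬ₘ φ)   = ¬ₘ sub σ φ
sub σ (φ ∧ₘ ψ) = sub σ φ ∧ₘ sub σ ψ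
sub σ (□ φ)    = □ sub σ φ

data NormalLogic (Ax : Fm → Set) : Fm → Set where
  taut : ∀ {φ} → Tautology φ → NormalLogic Ax φ
  kax  : ∀ φ ψ → NormalLogic Ax (□ (φ ⇒ ψ) ⇒ (□ φ ⇒ □ ψ))
  ax   : ∀ {φ} → Ax φ → NormalLogic Ax φ
  mp   : ∀ {φ ψ} → NormalLogic Ax (φ ⇒ ψ) → NormalLogic Ax φ → NormalLogic Ax ψ
  nec  : ∀ {φ} → NormalLogic Ax φ → NormalLogic Ax (□ φ)
  usub : ∀ {φ} (σ : ℕ → Fm) → NormalLogic Ax φ → NormalLogic Ax (sub σ φ)

Ax4 : Fm → Set
Ax4 χ = ∃ λ φ → χ ≡ (□ φ ⇒ □ □ φ)

ℙ : (n : ℕ) → (Fin (suc n) → Fm) → Fm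
ℙ zero    φs = ◇ φs zero
ℙ (suc n) φs = ◇ (φs (suc zero) ∧ₘ ℙ n φs′)
  where
  φs′ : Fin (suc n) → Fm
  φs′ zero    = φs zero
  φs′ (suc i) = φs (suc (suc i))

⋀ : List Fm → Fm
⋀ = foldr _∧ₘ_ ⊤ₘ

allFin′ : (n : ℕ) → List (Fin n)
allFin′ zero    = []
allFin′ (suc n) = zero ∷ map suc (allFin′ n)

-- 𝔻_n = ⋀_{i<j≤n} ¬(φ_i ∧ φ_j)  (= ⊤ for n = 0)
𝔻 : (n : ℕ) → (Fin (suc n) → Fm) → Fm
𝔻 zero    φs = ⊤ₘ
𝔻 (suc n) φs =
  𝔻 n (λ i → φs (inject₁ i)) ∧ₘ
  ⋀ (map (λ i → ¬ₘ (φs (inject₁ i) ∧ₘ φs (fromℕ (suc n)))) (allFin′ (suc n)))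

ℂ : (n : ℕ) → (Fin (suc n) → Fm) → Fm
ℂ n φs = □* (𝔻 n φs) ⇒ (◇ φs zero ⇒ ◇ (φs zero ∧ₘ ¬ₘ ℙ n φs))

AxC : ℕ → Fm → Set
AxC n χ = ∃ λ (φs : Fin (suc n) → Fm) → χ ≡ ℂ n φs

data AxK4C (n : ℕ) (χ : Fm) : Set where
  four : Ax4 χ → AxK4C n χ
  cn   : AxC n χ → AxK4C n χ

K4 : Fm → Set
K4 = NormalLogic Ax4

K4ℂ : ℕ → Fm → Set
K4ℂ n = NormalLogic (AxK4C n)

-- On a transitive frame with at most n worlds, a world satisfying ℙₙ(φ₀,…,φₙ) sees worlds
-- g 0, …, g n with g k ⊨ φₖ; by pigeonhole two of them coincide, which □*𝔻ₙ forbids. So ℂₙ is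
-- valid on such frames, and K4ℂₙ is sound for them.
--
-- Conversely K4 has the finite model property, shown constructively by the elimination method.
-- A type assigns truth values to the atoms of φ (its variables and boxed subformulas); put s ≺ t
-- when t makes χ and □χ true whenever s makes □χ true. Starting from all types, repeatedly delete
-- each type s making some □ψ false for which no remaining t with s ≺ t makes ψ false. Such an s
-- is K4-inconsistent: its characteristic formula implies □⋀(χ ∧ □χ) over its true boxes, and
-- that conjunction implies ψ because every type satisfying it and ¬ψ has already been refuted.
-- If φ holds in every surviving type it is derivable; otherwise the surviving types form a
-- transitive countermodel, which validates K4ℂ_N for N its number of worlds.

module Submission where

open import Defs
open import Data.Bool using (Bool; true; false; not; _∧_; T; if_then_else_)
import Data.Bool as Bool
open import Data.Bool.Properties using (T-∧; T-≡; T-not-≡; T?)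
open import Data.Empty using (⊥-elim)
open import Data.Fin using (Fin; zero; suc; inject₁; fromℕ)
open import Data.Fin.Properties using (all?; ¬∀⟶∃¬; pigeonhole; <-irrefl)
open import Data.Fin.Relation.Unary.Top using (View; view; ‵fromℕ; ‵inject₁)
open import Data.List using (List; []; _∷_; [_]; map; _++_; filter; length; lookup)
import Data.List.Membership.DecPropositional as DecMembership
open import Data.List.Membership.Propositional using (_∈_; _∉_; lose; find)
open import Data.List.Membership.Propositional.Properties
  using (∈-map⁺; ∈-++⁺ˡ; ∈-++⁺ʳ; ∈-++⁻; ∈-filter⁺; ∈-filter⁻; ∈-lookup)
open import Data.List.Properties using (filter-notAll)
open import Data.List.Relation.Binary.Subset.Propositional using (_⊆_)
open import Data.List.Relation.Unary.All as All using (All; []; _∷_)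
import Data.List.Relation.Unary.All.Properties as All
open import Data.List.Relation.Unary.Any as Any using (Any; here; there)
open import Data.List.Relation.Unary.Any.Properties using (lookup-index)
open import Data.Nat using (ℕ; zero; suc; _≤_; _<_; s≤s; _≟_)
open import Data.Nat.Properties using (≤-refl; <-≤-trans)
open import Data.Product using (_×_; _,_; ∃; proj₁; proj₂)
open import Data.Sum using (_⊎_; inj₁; inj₂; [_,_]′)
open import Data.Vec using (Vec; []; _∷_)
import Data.Vec as Vec
open import Data.Vec.Properties using (≡-dec)
open import Function using (_∘_; id)
open import Function.Bundles using (Equivalence; _⇔_)
open import Relation.Binary using (Decidable; DecidableEquality; Transitive)
open import Relation.Binary.PropositionalEquality using (_≡_; refl; sym; trans; cong; cong₂; subst)
open import Relation.Nullary using (¬_; Dec; yes; no; does; isYes; ¬?)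
open import Relation.Nullary.Decidable
  using (map′; _×-dec_; _→-dec_; decidable-stable)
  using (toWitness; fromWitness; toWitnessFalse; fromWitnessFalse)
import Relation.Unary as U

T-not⁺ : ∀ {a} → ¬ T a → T (not a)
T-not⁺ {false} _  = _
T-not⁺ {true}  ¬a = ¬a _

T-not⁻ : ∀ {a} → T (not a) → ¬ T a
T-not⁻ {false} _ ()

T-⇒⁺ : ∀ a {b} → (T a → T b) → T (not (a ∧ not b))
T-⇒⁺ false         _   = _
T-⇒⁺ true  {true}  _   = _
T-⇒⁺ true  {false} a⇒b = a⇒b _

T-⇒⁻ : ∀ {a b} → T (not (a ∧ not b)) → T a → T b
T-⇒⁻ {true} {true} _ _ = _

T-ext : ∀ {a b} → (T a → T b) → (T b → T a) → a ≡ b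
T-ext {false} {false} _ _   = refl
T-ext {false} {true}  _ b⇒a = ⊥-elim (b⇒a _)
T-ext {true}  {false} a⇒b _ = ⊥-elim (a⇒b _)
T-ext {true}  {true}  _ _   = refl

T-⋀⁻ : ∀ {v w} φs → T (eval v w (⋀ φs)) → All (T ∘ eval v w) φs
T-⋀⁻ []       _ = []
T-⋀⁻ (φ ∷ φs) h = let p , q = Equivalence.to T-∧ h in p ∷ T-⋀⁻ φs q

T-⋀⁺ : ∀ {v w φs} → All (T ∘ eval v w) φs → T (eval v w (⋀ φs))
T-⋀⁺ []       = _
T-⋀⁺ (p ∷ ps) = Equivalence.from T-∧ (p , T-⋀⁺ ps)

∈-allFin′ : ∀ {n} (k : Fin n) → k ∈ allFin′ n
∈-allFin′ zero    = here refl
∈-allFin′ (suc k) = there (∈-map⁺ suc (∈-allFin′ k))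

𝔻-disjoint : ∀ {v w} n φs {i j} → T (eval v w (𝔻 n φs)) →
             T (eval v w (φs i)) → T (eval v w (φs j)) → i ≡ j
𝔻-disjoint zero φs {zero} {zero} _ _ _ = refl
𝔻-disjoint {v} {w} (suc n) φs {i} {j} d = compare (view i) (view j)
  where
  last = fromℕ (suc n)
  separations = map (λ k → ¬ₘ (φs (inject₁ k) ∧ₘ φs last)) (allFin′ (suc n))
  earlier : T (eval v w (𝔻 n (φs ∘ inject₁)))
  earlier = proj₁ (Equivalence.to (T-∧ {y = eval v w (⋀ separations)}) d)
  separated : All (T ∘ eval v w) separations
  separated = T-⋀⁻ separations (proj₂ (Equivalence.to (T-∧ {eval v w (𝔻 n (φs ∘ inject₁))}) d))
  clash : ∀ k → T (eval v w (φs (inject₁ k))) → ¬ T (eval v w (φs last))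
  clash k p q = T-not⁻ (All.lookup separated (∈-map⁺ _ (∈-allFin′ k))) (Equivalence.from T-∧ (p , q))
  compare : ∀ {i j} → View i → View j → T (eval v w (φs i)) → T (eval v w (φs j)) → i ≡ j
  compare ‵fromℕ        ‵fromℕ        _ _ = refl
  compare ‵fromℕ        (‵inject₁ k)  p q = ⊥-elim (clash k q p)
  compare (‵inject₁ k)  ‵fromℕ        p q = ⊥-elim (clash k p q)
  compare (‵inject₁ _)  (‵inject₁ _)  p q = cong inject₁ (𝔻-disjoint n (φs ∘ inject₁) earlier p q)

-- Finite Kripke models

module FiniteModel {N : ℕ} {_R_ : Fin N → Fin N → Set} (_R?_ : Decidable _R_) where

  Valuation : Set
  Valuation = Fin N → ℕ → Bool

  sat : Valuation → Fin N → Fm → Bool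
  □? : ∀ V x φ → Dec (∀ y → x R y → T (sat V y φ))

  sat V x (var p)  = V x p
  sat V x ⊤ₘ       = true
  sat V x (¬ₘ φ)   = not (sat V x φ)
  sat V x (φ ∧ₘ ψ) = sat V x φ ∧ sat V x ψ
  sat V x (□ φ)    = isYes (□? V x φ)

  □? V x φ = all? λ y → x R? y →-dec T? (sat V y φ)

  Valid : Fm → Set
  Valid φ = ∀ V x → T (sat V x φ)

  module _ {V : Valuation} {x : Fin N} where

    □-intro : ∀ φ → (∀ {y} → x R y → T (sat V y φ)) → T (sat V x (□ φ))
    □-intro φ h = fromWitness {a? = □? V x φ} λ y → h

    □-elim : ∀ φ {y} → T (sat V x (□ φ)) → x R y → T (sat V y φ)
    □-elim φ h = toWitness {a? = □? V x φ} h _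

    ◇-intro : ∀ φ {y} → x R y → T (sat V y φ) → T (sat V x (◇ φ))
    ◇-intro φ {y} r s = fromWitnessFalse {a? = □? V x (¬ₘ φ)} λ all → T-not⁻ (all y r) s

    ◇-elim : ∀ φ → T (sat V x (◇ φ)) → ∃ λ y → x R y × T (sat V y φ)
    ◇-elim φ h with ¬∀⟶∃¬ N _ (λ y → x R? y →-dec T? _) (toWitnessFalse {a? = □? V x (¬ₘ φ)} h)
    ... | y , ¬[xRy⇒¬φ] =
      y , decidable-stable (x R? y) (λ ¬r → ¬[xRy⇒¬φ] (⊥-elim ∘ ¬r))
        , decidable-stable (T? _) (λ ¬s → ¬[xRy⇒¬φ] (λ _ → T-not⁺ ¬s))

  sat-eval : ∀ V x φ → sat V x φ ≡ eval (V x) (λ ψ → sat V x (□ ψ)) φ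
  sat-eval V x (var p)  = refl
  sat-eval V x ⊤ₘ       = refl
  sat-eval V x (¬ₘ φ)   = cong not (sat-eval V x φ)
  sat-eval V x (φ ∧ₘ ψ) = cong₂ _∧_ (sat-eval V x φ) (sat-eval V x ψ)
  sat-eval V x (□ φ)    = refl

  sat-sub : ∀ V σ x φ → sat V x (sub σ φ) ≡ sat (λ y p → sat V y (σ p)) x φ
  sat-sub V σ x (var p)  = refl
  sat-sub V σ x ⊤ₘ       = refl
  sat-sub V σ x (¬ₘ φ)   = cong not (sat-sub V σ x φ)
  sat-sub V σ x (φ ∧ₘ ψ) = cong₂ _∧_ (sat-sub V σ x φ) (sat-sub V σ x ψ)
  sat-sub V σ x (□ φ)    =
    T-ext (λ h → □-intro φ λ r → subst T (sat-sub V σ _ φ) (□-elim (sub σ φ) h r))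
          (λ h → □-intro (sub σ φ) λ r → subst T (sym (sat-sub V σ _ φ)) (□-elim φ h r))

  tautology-valid : ∀ {φ} → Tautology φ → Valid φ
  tautology-valid {φ} t V x =
    subst T (sym (trans (sat-eval V x φ) (t (V x) _))) _

  K-valid : ∀ φ ψ → Valid (□ (φ ⇒ ψ) ⇒ (□ φ ⇒ □ ψ))
  K-valid φ ψ V x = T-⇒⁺ (sat V x (□ (φ ⇒ ψ))) λ □φ⇒ψ → T-⇒⁺ (sat V x (□ φ)) λ □φ →
    □-intro ψ λ r → T-⇒⁻ (□-elim (φ ⇒ ψ) □φ⇒ψ r) (□-elim φ □φ r)

  normal-sound : ∀ {Ax φ} → (∀ {χ} → Ax χ → Valid χ) → NormalLogic Ax φ → Valid φ
  normal-sound ax-valid (taut {φ} t) = tautology-valid {φ} t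
  normal-sound ax-valid (kax φ ψ)    = K-valid φ ψ
  normal-sound ax-valid (ax a)       = ax-valid a
  normal-sound ax-valid (mp d e) V x = T-⇒⁻ (normal-sound ax-valid d V x) (normal-sound ax-valid e V x)
  normal-sound ax-valid (nec {φ} d) V x = □-intro φ λ {y} _ → normal-sound ax-valid d V y
  normal-sound ax-valid (usub {φ} σ d) V x =
    subst T (sym (sat-sub V σ x φ)) (normal-sound ax-valid d _ x)

  module _ (R-trans : Transitive _R_) where

    4-valid : ∀ φ → Valid (□ φ ⇒ □ □ φ)
    4-valid φ V x = T-⇒⁺ (sat V x (□ φ)) λ □φ →
      □-intro (□ φ) λ xRy → □-intro φ λ yRz → □-elim φ □φ (R-trans xRy yRz)

    ℙ-witnesses : ∀ {V u} n φs → T (sat V u (ℙ n φs)) →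
                  ∃ λ (g : Fin (suc n) → Fin N) → ∀ k → u R g k × T (sat V (g k) (φs k))
    ℙ-witnesses {V} {u} zero φs h with ◇-elim (φs zero) h
    ... | y , uRy , φ₀ = (λ _ → y) , λ { zero → uRy , φ₀ }
    -- The `_` is the family φs′ local to the definition of ℙ, which cannot be named here.
    ℙ-witnesses {V} {u} (suc n) φs h with ◇-elim (φs (suc zero) ∧ₘ ℙ n _) h
    ... | y , uRy , φ₁∧ℙ with Equivalence.to (T-∧ {sat V y (φs (suc zero))}) φ₁∧ℙ
    ... | φ₁ , ℙy with ℙ-witnesses n _ ℙy
    ... | g , hg = g′ , hg′
      where
      g′ : Fin (suc (suc n)) → Fin N
      g′ zero          = g zero
      g′ (suc zero)    = y
      g′ (suc (suc k)) = g (suc k)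
      hg′ : ∀ k → u R g′ k × T (sat V (g′ k) (φs k))
      hg′ zero          = R-trans uRy (proj₁ (hg zero)) , proj₂ (hg zero)
      hg′ (suc zero)    = uRy , φ₁
      hg′ (suc (suc k)) = R-trans uRy (proj₁ (hg (suc k))) , proj₂ (hg (suc k))

    ℂ-valid : ∀ {n} → N ≤ n → ∀ φs → Valid (ℂ n φs)
    ℂ-valid {n} N≤n φs V x =
      T-⇒⁺ (sat V x (□* (𝔻 n φs))) λ □*𝔻 → T-⇒⁺ (sat V x (◇ φs zero)) λ ◇φ₀ →
      let u , xRu , φ₀ = ◇-elim (φs zero) ◇φ₀ in
      ◇-intro (φs zero ∧ₘ ¬ₘ ℙ n φs) xRu (Equivalence.from T-∧ (φ₀ , T-not⁺ (no-chain □*𝔻 xRu)))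
      where
      sat⇒eval : ∀ {y} φ → T (sat V y φ) → T (eval (V y) (λ ψ → sat V y (□ ψ)) φ)
      sat⇒eval {y} φ = subst T (sat-eval V y φ)
      no-chain : T (sat V x (□* (𝔻 n φs))) → ∀ {u} → x R u → ¬ T (sat V u (ℙ n φs))
      no-chain □*𝔻 xRu ℙu with ℙ-witnesses n φs ℙu
      ... | g , hg with pigeonhole (s≤s N≤n) g
      ... | i , j , i<j , gi≡gj = <-irrefl i≡j i<j
        where
        □𝔻 = proj₂ (Equivalence.to (T-∧ {sat V x (𝔻 n φs)}) □*𝔻)
        𝔻-at-gi : T (sat V (g i) (𝔻 n φs))
        𝔻-at-gi = □-elim (𝔻 n φs) □𝔻 (R-trans xRu (proj₁ (hg i)))
        φj-at-gi : T (sat V (g i) (φs j))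
        φj-at-gi = subst (λ y → T (sat V y (φs j))) (sym gi≡gj) (proj₂ (hg j))
        i≡j = 𝔻-disjoint n φs (sat⇒eval (𝔻 n φs) 𝔻-at-gi)
                (sat⇒eval (φs i) (proj₂ (hg i))) (sat⇒eval (φs j) φj-at-gi)

    K4ℂ-valid : ∀ {n φ} → N ≤ n → K4ℂ n φ → Valid φ
    K4ℂ-valid N≤n = normal-sound λ { (four (φ , refl)) → 4-valid φ
                                   ; (cn (φs , refl))  → ℂ-valid N≤n φs }

record Countermodel (φ : Fm) : Set₁ where
  field
    size    : ℕ
    _R_     : Fin size → Fin size → Set
    _R?_    : Decidable _R_
    R-trans : Transitive _R_
    V       : FiniteModel.Valuation _R?_
    world   : Fin size
    refutes : ¬ T (FiniteModel.sat _R?_ V world φ)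

  not-K4ℂ : ¬ K4ℂ size φ
  not-K4ℂ K4ℂ⊢φ = refutes (FiniteModel.K4ℂ-valid _R?_ R-trans ≤-refl K4ℂ⊢φ V world)

-- Derived rules of normal logics

module _ {Ax : Fm → Set} where

  tautology : ∀ {φ} → (∀ v w → T (eval v w φ)) → NormalLogic Ax φ
  tautology t = taut λ v w → Equivalence.to T-≡ (t v w)

  taut-mp : ∀ {φ ψ} → (∀ v w → T (eval v w φ) → T (eval v w ψ)) →
            NormalLogic Ax φ → NormalLogic Ax ψ
  taut-mp {φ} φ⇒ψ = mp (tautology λ v w → T-⇒⁺ (eval v w φ) (φ⇒ψ v w))

  taut-mp₂ : ∀ {φ ψ χ} → (∀ v w → T (eval v w φ) → T (eval v w ψ) → T (eval v w χ)) →
             NormalLogic Ax φ → NormalLogic Ax ψ → NormalLogic Ax χ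
  taut-mp₂ {φ} {ψ} φ⇒ψ⇒χ d e =
    mp (mp (tautology λ v w → T-⇒⁺ (eval v w φ) λ a → T-⇒⁺ (eval v w ψ) (φ⇒ψ⇒χ v w a)) d) e

  ⇒-trans : ∀ {φ ψ χ} → NormalLogic Ax (φ ⇒ ψ) → NormalLogic Ax (ψ ⇒ χ) → NormalLogic Ax (φ ⇒ χ)
  ⇒-trans {φ} {ψ} = taut-mp₂ λ v w φ⇒ψ ψ⇒χ →
    T-⇒⁺ (eval v w φ) (T-⇒⁻ {eval v w ψ} ψ⇒χ ∘ T-⇒⁻ {eval v w φ} φ⇒ψ)

  ∧-⇒ : ∀ {φ ψ φ′ ψ′} → NormalLogic Ax (φ ⇒ φ′) → NormalLogic Ax (ψ ⇒ ψ′) →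
        NormalLogic Ax (φ ∧ₘ ψ ⇒ φ′ ∧ₘ ψ′)
  ∧-⇒ {φ} {ψ} = taut-mp₂ λ v w φ⇒φ′ ψ⇒ψ′ → T-⇒⁺ (eval v w φ ∧ eval v w ψ) λ φ∧ψ →
    let holdsφ , holdsψ = Equivalence.to T-∧ φ∧ψ in
    Equivalence.from T-∧ (T-⇒⁻ {eval v w φ} φ⇒φ′ holdsφ , T-⇒⁻ {eval v w ψ} ψ⇒ψ′ holdsψ)

  ⋀-intro : ∀ {φs} → All (NormalLogic Ax) φs → NormalLogic Ax (⋀ φs)
  ⋀-intro []       = tautology λ _ _ → _
  ⋀-intro (d ∷ ds) = taut-mp₂ (λ _ _ φ ψ → Equivalence.from T-∧ (φ , ψ)) d (⋀-intro ds)

  □-mono : ∀ {φ ψ} → NormalLogic Ax (φ ⇒ ψ) → NormalLogic Ax (□ φ ⇒ □ ψ)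
  □-mono {φ} {ψ} d = mp (kax φ ψ) (nec d)

  □-∧ : ∀ φ ψ → NormalLogic Ax (□ φ ∧ₘ □ ψ ⇒ □ (φ ∧ₘ ψ))
  □-∧ φ ψ = taut-mp₂ combine (□-mono pair) (kax ψ (φ ∧ₘ ψ))
    where
    pair : NormalLogic Ax (φ ⇒ (ψ ⇒ φ ∧ₘ ψ))
    pair = tautology λ v w → T-⇒⁺ (eval v w φ) λ a → T-⇒⁺ (eval v w ψ) λ b → Equivalence.from T-∧ (a , b)
    combine : ∀ v w → T (eval v w (□ φ ⇒ □ (ψ ⇒ φ ∧ₘ ψ))) →
              T (eval v w (□ (ψ ⇒ φ ∧ₘ ψ) ⇒ (□ ψ ⇒ □ (φ ∧ₘ ψ)))) →
              T (eval v w (□ φ ∧ₘ □ ψ ⇒ □ (φ ∧ₘ ψ)))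
    combine v w p q = T-⇒⁺ (w φ ∧ w ψ) λ □φ∧□ψ →
      let □φ , □ψ = Equivalence.to T-∧ □φ∧□ψ in
      T-⇒⁻ {w ψ} (T-⇒⁻ {w (ψ ⇒ φ ∧ₘ ψ)} q (T-⇒⁻ {w φ} p □φ)) □ψ

  ⋀⇒□⋀ : ∀ {A : Set} {α β : A → Fm} xs → (∀ x → NormalLogic Ax (α x ⇒ □ β x)) →
         NormalLogic Ax (⋀ (map α xs) ⇒ □ ⋀ (map β xs))
  ⋀⇒□⋀ [] _ = taut-mp (λ _ _ □⊤ → T-⇒⁺ true λ _ → □⊤) (nec (tautology λ _ _ → _))
  ⋀⇒□⋀ {β = β} (x ∷ xs) α⇒□β = ⇒-trans (∧-⇒ (α⇒□β x) (⋀⇒□⋀ xs α⇒□β)) (□-∧ (β x) (⋀ (map β xs)))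

NormalLogic-mono : ∀ {Ax Ax′ φ} → (∀ {χ} → Ax χ → Ax′ χ) → NormalLogic Ax φ → NormalLogic Ax′ φ
NormalLogic-mono Ax⊆Ax′ (taut t)   = taut t
NormalLogic-mono Ax⊆Ax′ (kax φ ψ)  = kax φ ψ
NormalLogic-mono Ax⊆Ax′ (ax a)     = ax (Ax⊆Ax′ a)
NormalLogic-mono Ax⊆Ax′ (mp d e)   = mp (NormalLogic-mono Ax⊆Ax′ d) (NormalLogic-mono Ax⊆Ax′ e)
NormalLogic-mono Ax⊆Ax′ (nec d)    = nec (NormalLogic-mono Ax⊆Ax′ d)
NormalLogic-mono Ax⊆Ax′ (usub σ d) = usub σ (NormalLogic-mono Ax⊆Ax′ d)

□⇒□□* : ∀ χ → K4 (□ χ ⇒ □ □* χ)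
□⇒□□* χ = taut-mp₂ (λ v w 4χ □χ∧□□χ⇒□□*χ → T-⇒⁺ (w χ) λ □χ →
                      T-⇒⁻ {w χ ∧ w (□ χ)} □χ∧□□χ⇒□□*χ (Equivalence.from T-∧ (□χ , T-⇒⁻ {w χ} 4χ □χ)))
                   (ax (χ , refl)) (□-∧ χ (□ χ))

-- Subformulas, atoms and types

_≟ₘ_ : DecidableEquality Fm
var p    ≟ₘ var q    = map′ (cong var) (λ { refl → refl }) (p ≟ q)
⊤ₘ       ≟ₘ ⊤ₘ       = yes refl
(¬ₘ φ)   ≟ₘ (¬ₘ ψ)   = map′ (cong ¬ₘ_) (λ { refl → refl }) (φ ≟ₘ ψ)
(φ ∧ₘ ψ) ≟ₘ (φ′ ∧ₘ ψ′) =
  map′ (λ { (refl , refl) → refl }) (λ { refl → refl , refl }) (φ ≟ₘ φ′ ×-dec ψ ≟ₘ ψ′)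
(□ φ)    ≟ₘ (□ ψ)    = map′ (cong □_) (λ { refl → refl }) (φ ≟ₘ ψ)
var _    ≟ₘ ⊤ₘ       = no λ ()
var _    ≟ₘ (¬ₘ _)   = no λ ()
var _    ≟ₘ (_ ∧ₘ _) = no λ ()
var _    ≟ₘ (□ _)    = no λ ()
⊤ₘ       ≟ₘ var _    = no λ ()
⊤ₘ       ≟ₘ (¬ₘ _)   = no λ ()
⊤ₘ       ≟ₘ (_ ∧ₘ _) = no λ ()
⊤ₘ       ≟ₘ (□ _)    = no λ ()
(¬ₘ _)   ≟ₘ var _    = no λ ()
(¬ₘ _)   ≟ₘ ⊤ₘ       = no λ ()
(¬ₘ _)   ≟ₘ (_ ∧ₘ _) = no λ ()
(¬ₘ _)   ≟ₘ (□ _)    = no λ ()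
(_ ∧ₘ _) ≟ₘ var _    = no λ ()
(_ ∧ₘ _) ≟ₘ ⊤ₘ       = no λ ()
(_ ∧ₘ _) ≟ₘ (¬ₘ _)   = no λ ()
(_ ∧ₘ _) ≟ₘ (□ _)    = no λ ()
(□ _)    ≟ₘ var _    = no λ ()
(□ _)    ≟ₘ ⊤ₘ       = no λ ()
(□ _)    ≟ₘ (¬ₘ _)   = no λ ()
(□ _)    ≟ₘ (_ ∧ₘ _) = no λ ()

infix 4 _⊑_

data _⊑_ : Fm → Fm → Set where
  ⊑-refl : ∀ {φ} → φ ⊑ φ
  ⊑-¬    : ∀ {φ ψ} → φ ⊑ ψ → φ ⊑ ¬ₘ ψ
  ⊑-∧ˡ   : ∀ {φ ψ θ} → φ ⊑ ψ → φ ⊑ ψ ∧ₘ θ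
  ⊑-∧ʳ   : ∀ {φ ψ θ} → φ ⊑ θ → φ ⊑ ψ ∧ₘ θ
  ⊑-□    : ∀ {φ ψ} → φ ⊑ ψ → φ ⊑ □ ψ

⊑-trans : ∀ {φ ψ θ} → φ ⊑ ψ → ψ ⊑ θ → φ ⊑ θ
⊑-trans φ⊑ψ ⊑-refl     = φ⊑ψ
⊑-trans φ⊑ψ (⊑-¬ h)    = ⊑-¬ (⊑-trans φ⊑ψ h)
⊑-trans φ⊑ψ (⊑-∧ˡ h)   = ⊑-∧ˡ (⊑-trans φ⊑ψ h)
⊑-trans φ⊑ψ (⊑-∧ʳ h)   = ⊑-∧ʳ (⊑-trans φ⊑ψ h)
⊑-trans φ⊑ψ (⊑-□ h)    = ⊑-□ (⊑-trans φ⊑ψ h)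

atoms : Fm → List Fm
atoms (var p)  = [ var p ]
atoms ⊤ₘ       = []
atoms (¬ₘ φ)   = atoms φ
atoms (φ ∧ₘ ψ) = atoms φ ++ atoms ψ
atoms (□ φ)    = □ φ ∷ atoms φ

boxes : Fm → List Fm
boxes (var p)  = []
boxes ⊤ₘ       = []
boxes (¬ₘ φ)   = boxes φ
boxes (φ ∧ₘ ψ) = boxes φ ++ boxes ψ
boxes (□ φ)    = φ ∷ boxes φ

atoms-mono : ∀ {φ ψ} → φ ⊑ ψ → atoms φ ⊆ atoms ψ
atoms-mono ⊑-refl                   a∈ = a∈
atoms-mono (⊑-¬ h)                  a∈ = atoms-mono h a∈
atoms-mono (⊑-∧ˡ h)                 a∈ = ∈-++⁺ˡ (atoms-mono h a∈)
atoms-mono (⊑-∧ʳ {ψ = ψ} h)         a∈ = ∈-++⁺ʳ (atoms ψ) (atoms-mono h a∈)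
atoms-mono (⊑-□ h)                  a∈ = there (atoms-mono h a∈)

boxes-mono : ∀ {φ ψ} → φ ⊑ ψ → boxes φ ⊆ boxes ψ
boxes-mono ⊑-refl                   χ∈ = χ∈
boxes-mono (⊑-¬ h)                  χ∈ = boxes-mono h χ∈
boxes-mono (⊑-∧ˡ h)                 χ∈ = ∈-++⁺ˡ (boxes-mono h χ∈)
boxes-mono (⊑-∧ʳ {ψ = ψ} h)         χ∈ = ∈-++⁺ʳ (boxes ψ) (boxes-mono h χ∈)
boxes-mono (⊑-□ h)                  χ∈ = there (boxes-mono h χ∈)

∈-boxes⇒□⊑ : ∀ {χ} φ → χ ∈ boxes φ → □ χ ⊑ φ
∈-boxes⇒□⊑ (¬ₘ φ)   χ∈ = ⊑-¬ (∈-boxes⇒□⊑ φ χ∈)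
∈-boxes⇒□⊑ (φ ∧ₘ ψ) χ∈ with ∈-++⁻ (boxes φ) χ∈
... | inj₁ χ∈φ = ⊑-∧ˡ (∈-boxes⇒□⊑ φ χ∈φ)
... | inj₂ χ∈ψ = ⊑-∧ʳ (∈-boxes⇒□⊑ ψ χ∈ψ)
∈-boxes⇒□⊑ (□ φ)    (here refl) = ⊑-refl
∈-boxes⇒□⊑ (□ φ)    (there χ∈)  = ⊑-□ (∈-boxes⇒□⊑ φ χ∈)

Type : List Fm → Set
Type As = Vec Bool (length As)

value : ∀ As → Type As → Fm → Bool
value []       []       a = false
value (b ∷ As) (x ∷ s)  a = if does (b ≟ₘ a) then x else value As s a

literal : Fm → Bool → Fm
literal a true  = a
literal a false = ¬ₘ a

chr : ∀ As → Type As → Fm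
chr []       []      = ⊤ₘ
chr (a ∷ As) (x ∷ s) = literal a x ∧ₘ chr As s

typeOf : (ℕ → Bool) → (Fm → Bool) → ∀ As → Type As
typeOf v w As = Vec.map (eval v w) (Vec.fromList As)

allVecs : ∀ n → List (Vec Bool n)
allVecs zero    = [ [] ]
allVecs (suc n) = map (true ∷_) (allVecs n) ++ map (false ∷_) (allVecs n)

∈-allVecs : ∀ {n} (s : Vec Bool n) → s ∈ allVecs n
∈-allVecs []          = here refl
∈-allVecs (true ∷ s)  = ∈-++⁺ˡ (∈-map⁺ (true ∷_) (∈-allVecs s))
∈-allVecs (false ∷ s) = ∈-++⁺ʳ (map (true ∷_) (allVecs _)) (∈-map⁺ (false ∷_) (∈-allVecs s))

module _ {v : ℕ → Bool} {w : Fm → Bool} where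

  literal-holds : ∀ a x → T (eval v w (literal a x)) ⇔ (eval v w a ≡ x)
  literal-holds a true  = T-≡
  literal-holds a false = T-not-≡

  chr-typeOf : ∀ As → T (eval v w (chr As (typeOf v w As)))
  chr-typeOf []       = _
  chr-typeOf (a ∷ As) = Equivalence.from T-∧ (Equivalence.from (literal-holds a _) refl , chr-typeOf As)

  chr⇒value : ∀ As {s} → T (eval v w (chr As s)) → ∀ {a} → a ∈ As → eval v w a ≡ value As s a
  chr⇒value (b ∷ As) {x ∷ s} h {a} a∈ with b ≟ₘ a | Equivalence.to (T-∧ {eval v w (literal b x)}) h
  ... | yes refl | b≡x , _ = Equivalence.to (literal-holds b x) b≡x
  ... | no b≢a   | _ , rest with a∈
  ...   | here refl  = ⊥-elim (b≢a refl)
  ...   | there a∈As = chr⇒value As rest a∈As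

  value-typeOf : ∀ {As a} → a ∈ As → value As (typeOf v w As) a ≡ eval v w a
  value-typeOf {As} a∈ = sym (chr⇒value As (chr-typeOf As) a∈)

-- Every valuation realises its own type, and the characteristic formula of that type is true,
-- so it cannot be one of the refuted ones.
derivable-from-refuted-types :
  ∀ {Ax As θ} {Q : Type As → Set} → U.Decidable Q →
  (∀ s → Q s → NormalLogic Ax (¬ₘ chr As s)) →
  (∀ v w → ¬ Q (typeOf v w As) → T (eval v w θ)) →
  NormalLogic Ax θ
derivable-from-refuted-types {As = As} {θ} {Q} Q? refuted holds =
  taut-mp outside-refuted (⋀-intro (All.map⁺ (All.tabulate λ s∈ → refuted _ (refuted-type s∈))))
  where
  refutedTypes : List (Type As)
  refutedTypes = filter Q? (allVecs (length As))
  refuted-type : ∀ {s} → s ∈ refutedTypes → Q s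
  refuted-type = proj₂ ∘ ∈-filter⁻ Q? {xs = allVecs _}
  outside-refuted : ∀ v w → T (eval v w (⋀ (map (¬ₘ_ ∘ chr As) refutedTypes))) → T (eval v w θ)
  outside-refuted v w h with Q? (typeOf v w As)
  ... | no ¬q = holds v w ¬q
  ... | yes q = ⊥-elim (T-not⁻ (All.lookup (T-⋀⁻ _ h) (∈-map⁺ _ typeOf∈refuted)) (chr-typeOf As))
    where
    typeOf∈refuted : typeOf v w As ∈ refutedTypes
    typeOf∈refuted = ∈-filter⁺ Q? (∈-allVecs _) q

-- Elimination of unrealised types

module Elimination (φ : Fm) where

  As : List Fm
  As = atoms φ

  evalAt : Type As → Fm → Bool
  evalAt s = eval (λ p → value As s (var p)) (λ ψ → value As s (□ ψ))

  evalAt-typeOf : ∀ {v w χ} → χ ⊑ φ → evalAt (typeOf v w As) χ ≡ eval v w χ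
  evalAt-typeOf {χ = var p}  h = value-typeOf (atoms-mono h (here refl))
  evalAt-typeOf {χ = ⊤ₘ}     h = refl
  evalAt-typeOf {χ = ¬ₘ χ}   h = cong not (evalAt-typeOf (⊑-trans (⊑-¬ ⊑-refl) h))
  evalAt-typeOf {χ = χ ∧ₘ ψ} h =
    cong₂ _∧_ (evalAt-typeOf (⊑-trans (⊑-∧ˡ ⊑-refl) h)) (evalAt-typeOf (⊑-trans (⊑-∧ʳ ⊑-refl) h))
  evalAt-typeOf {χ = □ χ}    h = value-typeOf (atoms-mono h (here refl))

  infix 4 _≺_

  _≺_ : Type As → Type As → Set
  s ≺ t = All (λ χ → T (evalAt s (□ χ)) → T (evalAt t (□ χ)) × T (evalAt t χ)) (boxes φ)

  _≺?_ : Decidable _≺_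
  s ≺? t = All.all? (λ χ → T? (evalAt s (□ χ)) →-dec (T? (evalAt t (□ χ)) ×-dec T? (evalAt t χ)))
                    (boxes φ)

  ≺-trans : Transitive _≺_
  ≺-trans s≺t t≺u = All.zipWith (λ (s→t , t→u) □χ-at-s → t→u (proj₁ (s→t □χ-at-s))) (s≺t , t≺u)

  Witnessed : List (Type As) → Type As → Fm → Set
  Witnessed L s ψ = ¬ T (evalAt s (□ ψ)) → Any (λ t → s ≺ t × ¬ T (evalAt t ψ)) L

  Witnessed? : ∀ L s ψ → Dec (Witnessed L s ψ)
  Witnessed? L s ψ =
    ¬? (T? (evalAt s (□ ψ))) →-dec Any.any? (λ t → s ≺? t ×-dec ¬? (T? (evalAt t ψ))) L

  Realised : List (Type As) → Type As → Set
  Realised L s = All (Witnessed L s) (boxes φ)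

  Realised? : ∀ L → U.Decidable (Realised L)
  Realised? L s = All.all? (Witnessed? L s) (boxes φ)

  Inconsistent : Type As → Set
  Inconsistent s = K4 (¬ₘ chr As s)

  CoversConsistent : List (Type As) → Set
  CoversConsistent L = ∀ s → s ∉ L → Inconsistent s

  boxedAt : Type As → List Fm
  boxedAt s = filter (λ χ → T? (evalAt s (□ χ))) (boxes φ)

  chr⇒□boxedAt : ∀ s → K4 (chr As s ⇒ ⋀ (map □_ (boxedAt s)))
  chr⇒□boxedAt s = tautology λ v w → T-⇒⁺ (eval v w (chr As s)) λ c →
    T-⋀⁺ (All.map⁺ (All.tabulate λ χ∈ →
      let χ∈boxes , □χ-at-s = ∈-filter⁻ (λ χ → T? (evalAt s (□ χ))) {xs = boxes φ} χ∈ in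
      subst T (sym (chr⇒value As c (atoms-mono (∈-boxes⇒□⊑ φ χ∈boxes) (here refl)))) □χ-at-s))

  ≺-typeOf : ∀ {v w} s → T (eval v w (⋀ (map □* (boxedAt s)))) → s ≺ typeOf v w As
  ≺-typeOf s h = All.tabulate λ {χ} χ∈ □χ-at-s →
    let χ∧□χ = All.lookup (T-⋀⁻ _ h) (∈-map⁺ □* (∈-filter⁺ (λ χ → T? (evalAt s (□ χ))) χ∈ □χ-at-s))
        χ-holds , □χ-holds = Equivalence.to T-∧ χ∧□χ
        □χ⊑φ = ∈-boxes⇒□⊑ φ χ∈
    in subst T (sym (evalAt-typeOf □χ⊑φ)) □χ-holds ,
       subst T (sym (evalAt-typeOf (⊑-trans (⊑-□ ⊑-refl) □χ⊑φ))) χ-holds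

  unwitnessed-inconsistent : ∀ {L s ψ} → CoversConsistent L → ψ ∈ boxes φ → ¬ T (evalAt s (□ ψ)) →
                             ¬ Any (λ t → s ≺ t × ¬ T (evalAt t ψ)) L → Inconsistent s
  unwitnessed-inconsistent {L} {s} {ψ} covers ψ∈ ¬□ψ no-witness =
    taut-mp refutes-chr
      (⇒-trans (chr⇒□boxedAt s) (⇒-trans (⋀⇒□⋀ (boxedAt s) □⇒□□*) (□-mono boxed⇒ψ)))
    where
    □ψ⊑φ = ∈-boxes⇒□⊑ φ ψ∈
    boxed⇒ψ : K4 (⋀ (map □* (boxedAt s)) ⇒ ψ)
    boxed⇒ψ = derivable-from-refuted-types (λ t → s ≺? t ×-dec ¬? (T? (evalAt t ψ)))
      (λ t counterexample → covers t λ t∈L → no-witness (lose t∈L counterexample))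
      (λ v w ¬counterexample → T-⇒⁺ _ λ h → decidable-stable (T? _) λ ¬ψ →
        ¬counterexample (≺-typeOf s h , ¬ψ ∘ subst T (evalAt-typeOf (⊑-trans (⊑-□ ⊑-refl) □ψ⊑φ))))
    refutes-chr : ∀ v w → T (eval v w (chr As s ⇒ □ ψ)) → T (eval v w (¬ₘ chr As s))
    refutes-chr v w h = T-not⁺ λ c →
      ¬□ψ (subst T (chr⇒value As c (atoms-mono □ψ⊑φ (here refl))) (T-⇒⁻ {eval v w (chr As s)} h c))

  unrealised-inconsistent : ∀ {L s} → CoversConsistent L → ¬ Realised L s → Inconsistent s
  unrealised-inconsistent {L} {s} covers ¬realised
    with find (All.¬All⇒Any¬ (Witnessed? L s) (boxes φ) ¬realised)
  ... | ψ , ψ∈ , ¬witnessed =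
    unwitnessed-inconsistent covers ψ∈ (λ □ψ → ¬witnessed λ ¬□ψ → ⊥-elim (¬□ψ □ψ))
                                       (λ witness → ¬witnessed λ _ → witness)

  open DecMembership (≡-dec {n = length As} Bool._≟_) using (_∈?_)

  prune : List (Type As) → List (Type As)
  prune L = filter (Realised? L) L

  prune-covers : ∀ {L} → CoversConsistent L → CoversConsistent (prune L)
  prune-covers {L} covers s s∉ with s ∈? L
  ... | no s∉L  = covers s s∉L
  ... | yes s∈L = unrealised-inconsistent covers (s∉ ∘ ∈-filter⁺ (Realised? L) s∈L)

  saturate : ∃ λ L → CoversConsistent L × All (Realised L) L
  saturate = iterate _ (allVecs (length As)) ≤-refl (λ s s∉ → ⊥-elim (s∉ (∈-allVecs s)))
    where
    iterate : ∀ fuel L → length L < fuel → CoversConsistent L →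
              ∃ λ L → CoversConsistent L × All (Realised L) L
    iterate (suc fuel) L (s≤s |L|≤fuel) covers with All.all? (Realised? L) L
    ... | yes closed = L , covers , closed
    ... | no ¬closed = iterate fuel (prune L)
      (<-≤-trans (filter-notAll (Realised? L) L (All.¬All⇒Any¬ (Realised? L) L ¬closed)) |L|≤fuel)
      (prune-covers covers)

  module Model (L : List (Type As)) (closed : All (Realised L) L) where

    _⇝?_ : Decidable (λ i j → lookup L i ≺ lookup L j)
    i ⇝? j = lookup L i ≺? lookup L j

    open FiniteModel _⇝?_

    V : Valuation
    V i p = value As (lookup L i) (var p)

    truth : ∀ {χ} → χ ⊑ φ → ∀ i → sat V i χ ≡ evalAt (lookup L i) χ
    truth {var p}  h i = refl
    truth {⊤ₘ}     h i = refl
    truth {¬ₘ χ}   h i = cong not (truth (⊑-trans (⊑-¬ ⊑-refl) h) i)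
    truth {χ ∧ₘ ψ} h i =
      cong₂ _∧_ (truth (⊑-trans (⊑-∧ˡ ⊑-refl) h) i) (truth (⊑-trans (⊑-∧ʳ ⊑-refl) h) i)
    truth {□ ψ}    h i = T-ext forward backward
      where
      ψ⊑φ = ⊑-trans (⊑-□ ⊑-refl) h
      ψ∈  = boxes-mono h (here refl)
      forward : T (sat V i (□ ψ)) → T (evalAt (lookup L i) (□ ψ))
      forward □ψ = decidable-stable (T? _) λ ¬□ψ →
        let witness = All.lookup (All.lookup closed (∈-lookup {xs = L} i)) ψ∈ ¬□ψ
            i⇝j , ¬ψ = lookup-index witness
        in ¬ψ (subst T (truth ψ⊑φ (Any.index witness)) (□-elim ψ □ψ i⇝j))
      backward : T (evalAt (lookup L i) (□ ψ)) → T (sat V i (□ ψ))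
      backward □ψ = □-intro ψ λ {j} i⇝j → subst T (sym (truth ψ⊑φ j)) (proj₂ (All.lookup i⇝j ψ∈ □ψ))

  derivable-or-countermodel : K4 φ ⊎ Countermodel φ
  derivable-or-countermodel with saturate
  ... | L , covers , closed with All.all? (λ s → T? (evalAt s φ)) L
  ... | yes valid = inj₁ (derivable-from-refuted-types (λ s → ¬? (s ∈? L)) covers λ v w ¬∉ →
    subst T (evalAt-typeOf ⊑-refl) (All.lookup valid (decidable-stable (_ ∈? L) ¬∉)))
  ... | no invalid = inj₂ record
    { _R?_    = _⇝?_
    ; R-trans = ≺-trans
    ; V       = V
    ; world   = Any.index falsified
    ; refutes = lookup-index falsified ∘ subst T (truth ⊑-refl _)
    }
    where
    open Model L closed
    falsified = All.¬All⇒Any¬ (λ s → T? (evalAt s φ)) L invalid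

K4-finite-model-property : ∀ φ → K4 φ ⊎ Countermodel φ
K4-finite-model-property φ = Elimination.derivable-or-countermodel φ

corollary6p3 : (φ : Fm) → (K4 φ → (n : ℕ) → K4ℂ n φ) × (((n : ℕ) → K4ℂ n φ) → K4 φ)
corollary6p3 φ =
  (λ K4⊢φ n → NormalLogic-mono four K4⊢φ) ,
  (λ K4ℂ⊢φ → [ id , (λ M → ⊥-elim (Countermodel.not-K4ℂ M (K4ℂ⊢φ _))) ]′
               (K4-finite-model-property φ))
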